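{- Let $G$ be a graph of treelength at most $k\geq 1$ and let $A \subseteq V(G)$. If the induced subgraph $G[A]$ is connected, then every shortest path in $G$ between two vertices $a,b \in A$ is contained in $N^{\leq 3k/2}[A]$.
   Context: Graphs are simple, undirected and connected. For a set $A\subseteq V(G)$ and $i\ge 0$, $N^{\leq i}_G[A] = \{v \in V(G) : \exists a\in A,\ d_G(v,a)\le i\}$, where $d_G$ is the shortest path distance in $G$. A tree decomposition of $G$ is a pair $(T,(B_t)_{t\in V(T)})$ where $T$ is a tree and $B_t\subseteq V(G)$, such that for every $v\in V(G)$ the set $\{t : v\in B_t\}$ is nonempty and induces a subtree of $T$, and every edge of $G$ is contained in some bag $B_t$. The treelength of $G$ is the minimum integer $k$ such that $G$ has a tree decomposition in which $d_G(u,v)\le k$ for all $u,v$ lying in a common bag (distances measured in the whole graph $G$). -}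

module Defs where

open import Data.Nat using (ℕ; suc; _≤_; _*_)
open import Data.Nat.DivMod using (_/_)
open import Data.Fin using (Fin; zero; suc; fromℕ; inject₁)
open import Data.Product using (Σ; ∃; ∃-syntax; _×_)
open import Relation.Binary.PropositionalEquality using (_≡_)
open import Relation.Nullary using (¬_)

record Walk {V : Set} (E : V → V → Set) (u v : V) (l : ℕ) : Set where
  field
    vtx   : Fin (suc l) → V
    start : vtx zero ≡ u
    end   : vtx (fromℕ l) ≡ v
    step  : (i : Fin l) → E (vtx (inject₁ i)) (vtx (suc i))
open Walk public

WalkWithin : {V : Set} {E : V → V → Set} {u v : V} {l : ℕ} →
             (V → Set) → Walk E u v l → Set
WalkWithin {l = l} S w = (i : Fin (suc l)) → S (vtx w i)

Connected : {V : Set} → (V → V → Set) → Set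
Connected E = ∀ u v → ∃[ l ] Walk E u v l

record Graph : Set₁ where
  field
    n         : ℕ
    Adj       : Fin n → Fin n → Set
    sym       : ∀ {u v} → Adj u v → Adj v u
    irrefl    : ∀ u → ¬ Adj u u
    connected : Connected Adj
open Graph public

DistLe : (G : Graph) → Fin (n G) → Fin (n G) → ℕ → Set
DistLe G u v r = ∃[ l ] (l ≤ r × Walk (Adj G) u v l)

N≤ : (G : Graph) → ℕ → (Fin (n G) → Set) → Fin (n G) → Set
N≤ G r A v = ∃[ a ] (A a × DistLe G v a r)

IsShortestPath : (G : Graph) {a b : Fin (n G)} {l : ℕ} → Walk (Adj G) a b l → Set
IsShortestPath G {a} {b} {l} _ = ∀ l' → Walk (Adj G) a b l' → l ≤ l'

InducedConnected : (G : Graph) → (Fin (n G) → Set) → Set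
InducedConnected G A =
  ∀ a b → A a → A b → Σ ℕ λ l → Σ (Walk (Adj G) a b l) λ w → WalkWithin A w

HasCycle : {m : ℕ} → (Fin m → Fin m → Set) → Set
HasCycle {m} E =
  Σ (Fin m) λ u → Σ ℕ λ l → 3 ≤ l × Σ (Walk E u u l) λ w →
    ((i j : Fin l) → vtx w (inject₁ i) ≡ vtx w (inject₁ j) → i ≡ j)

record Tree : Set₁ where
  field
    m         : ℕ
    TAdj      : Fin m → Fin m → Set
    tsym      : ∀ {s t} → TAdj s t → TAdj t s
    tirrefl   : ∀ t → ¬ TAdj t t
    tconnected : Connected TAdj
    acyclic   : ¬ HasCycle TAdj
open Tree public

record TreeDecomposition (G : Graph) : Set₁ where
  field
    T       : Tree
    bag     : Fin (m T) → Fin (n G) → Set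
    covers  : ∀ v → ∃[ t ] bag t v
    subtree : ∀ v s t → bag s v → bag t v →
              Σ ℕ λ l → Σ (Walk (TAdj T) s t l) λ w → WalkWithin (λ t' → bag t' v) w
    edges   : ∀ u v → Adj G u v → ∃[ t ] (bag t u × bag t v)
open TreeDecomposition public

LengthAtMost : (G : Graph) → TreeDecomposition G → ℕ → Set
LengthAtMost G D k = ∀ t u v → bag D t u → bag D t v → DistLe G u v k

TreelengthAtMost : Graph → ℕ → Set₁
TreelengthAtMost G k = Σ (TreeDecomposition G) λ D → LengthAtMost G D k

threeHalves : ℕ → ℕ
threeHalves k = (3 * k) / 2

module Submission where

open import Defs
open import Data.Nat using (ℕ; zero; suc; _≤_; _<_; _+_; _*_; z≤n; s≤s; _≤?_)
open import Data.Nat.Properties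
  using (≤-refl; ≤-trans; <-≤-trans; m≤n⇒m≤1+n; +-mono-≤; +-mono-<-≤; +-mono-≤-<;
         +-monoˡ-≤; +-monoʳ-≤; +-cancelˡ-≤; +-cancelʳ-≤; ≰⇒>; <⇒≤; module ≤-Reasoning)
open import Data.Nat.DivMod using (_/_; m*n/n≡m; /-monoˡ-≤)
open import Data.Nat.Induction using (<-wellFounded)
open import Data.Nat.Solver using (module +-*-Solver)
open import Induction.WellFounded using (Acc; acc)
open import Data.Fin using (Fin; zero; suc; fromℕ; inject₁; _≟_)
open import Data.Product using (Σ; ∃; ∃₂; _×_; _,_; proj₁)
open import Data.Sum using (_⊎_; inj₁; inj₂)
open import Data.Empty using (⊥; ⊥-elim)
open import Data.List using (List; []; _∷_; _++_; tabulate)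
open import Data.List.Relation.Unary.All as All using (All; []; _∷_)
open import Data.List.Relation.Unary.All.Properties using (¬Any⇒All¬; tabulate⁺)
open import Data.List.Relation.Unary.Any using (here; there; any?)
open import Data.List.Membership.Propositional using (_∈_; _∉_; find; lose)
open import Data.List.Membership.Propositional.Properties using (∈-++⁻; ∈-tabulate⁺)
open import Data.List.Relation.Unary.AllPairs using ([]; _∷_)
open import Data.List.Relation.Unary.Unique.Propositional using (Unique)
open import Data.List.Relation.Unary.Unique.Propositional.Properties using (++⁺)
open import Data.List.Relation.Binary.Disjoint.Propositional using (Disjoint)
open import Relation.Binary.Definitions using (DecidableEquality)
open import Relation.Binary.PropositionalEquality as ≡
  using (_≡_; refl; cong; subst; subst₂)
open import Relation.Nullary using (yes; no)

-- Let v lie on a shortest path from a to b, cut at v into P₁ (from a) and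
-- P₂ (to b). The bags meeting P₁, those meeting P₂ and those meeting A form
-- three subtrees of T which pairwise share a bag (those of a, v and b), so by
-- the Helly property some bag contains g₁ ∈ P₁, g₂ ∈ P₂ and q ∈ A. Since the
-- path is shortest, d(g₁,v) + d(v,g₂) = d(g₁,g₂) ≤ k, so v lies within k/2
-- of g₁ or of g₂, and these lie within k of q.

Disjoint-++⁺ʳ : ∀ {A : Set} {xs ys zs : List A} →
                Disjoint xs ys → Disjoint xs zs → Disjoint xs (ys ++ zs)
Disjoint-++⁺ʳ {ys = ys} dy dz (x∈ , x∈++) with ∈-++⁻ ys x∈++
... | inj₁ x∈ys = dy (x∈ , x∈ys)
... | inj₂ x∈zs = dz (x∈ , x∈zs)

data Chain {V : Set} (E : V → V → Set) : V → V → ℕ → Set where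
  ε   : ∀ {u} → Chain E u u 0
  _◅_ : ∀ {u w v l} → E u w → Chain E w v l → Chain E u v (suc l)

infixr 5 _◅_

module _ {V : Set} {E : V → V → Set} where

  tailVertices : ∀ {u v l} → Chain E u v l → List V
  vertices     : ∀ {u v l} → Chain E u v l → List V

  vertices {u} w = u ∷ tailVertices w
  tailVertices ε       = []
  tailVertices (_ ◅ w) = vertices w

  initVertices : ∀ {u v l} → Chain E u v l → List V
  initVertices ε           = []
  initVertices {u} (_ ◅ w) = u ∷ initVertices w

  last∈vertices : ∀ {u v l} (w : Chain E u v l) → v ∈ vertices w
  last∈vertices ε       = here refl
  last∈vertices (_ ◅ w) = there (last∈vertices w)

  initVertices⊆vertices : ∀ {u v l g} (w : Chain E u v l) → g ∈ initVertices w → g ∈ vertices w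
  initVertices⊆vertices (_ ◅ w) (here refl) = here refl
  initVertices⊆vertices (_ ◅ w) (there g∈)  = there (initVertices⊆vertices w g∈)

  All-last : ∀ {P : V → Set} {u v l} (w : Chain E u v l) → All P (vertices w) → P v
  All-last w ps = All.lookup ps (last∈vertices w)

  infixr 5 _◅◅_
  _◅◅_ : ∀ {u v w l l′} → Chain E u v l → Chain E v w l′ → Chain E u w (l + l′)
  ε       ◅◅ w′ = w′
  (e ◅ w) ◅◅ w′ = e ◅ (w ◅◅ w′)

  All-◅◅ : ∀ {P : V → Set} {u v w l l′} (w₁ : Chain E u v l) (w₂ : Chain E v w l′) →
           All P (vertices w₁) → All P (vertices w₂) → All P (vertices (w₁ ◅◅ w₂))
  All-◅◅ ε        w₂ _        ps₂ = ps₂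
  All-◅◅ (_ ◅ w₁) w₂ (p ∷ ps₁) ps₂ = p ∷ All-◅◅ w₁ w₂ ps₁ ps₂

  initVertices-◅◅ : ∀ {u v w l l′} (w₁ : Chain E u v l) (w₂ : Chain E v w l′) →
                    initVertices (w₁ ◅◅ w₂) ≡ initVertices w₁ ++ initVertices w₂
  initVertices-◅◅ ε            w₂ = refl
  initVertices-◅◅ {u} (_ ◅ w₁) w₂ = cong (u ∷_) (initVertices-◅◅ w₁ w₂)

  _▻_ : ∀ {u v w l} → Chain E u v l → E v w → Chain E u w (suc l)
  ε       ▻ e′ = e′ ◅ ε
  (e ◅ w) ▻ e′ = e ◅ (w ▻ e′)

  reverse : (∀ {x y} → E x y → E y x) → ∀ {u v l} → Chain E u v l → Chain E v u l
  reverse flip ε       = ε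
  reverse flip (e ◅ w) = reverse flip w ▻ flip e

  split : ∀ {u v l g} (w : Chain E u v l) → g ∈ vertices w →
          ∃₂ λ l₁ l₂ → l₁ + l₂ ≡ l × Chain E u g l₁ × Chain E g v l₂
  split w       (here refl) = 0 , _ , refl , ε , w
  split (e ◅ w) (there g∈)  with split w g∈
  ... | l₁ , l₂ , refl , w₁ , w₂ = suc l₁ , l₂ , refl , e ◅ w₁ , w₂

  Within : (V → Set) → V → V → (ℕ → Set) → Set
  Within P u v Bound = Σ ℕ λ l → Bound l × Σ (Chain E u v l) λ w → All P (vertices w)

  prefix : ∀ {P : V → Set} {u v l g} (w : Chain E u v l) → All P (vertices w) →
           g ∈ initVertices w → Within P u g (_< l)
  prefix (_ ◅ w) (p ∷ _)  (here refl) = 0 , s≤s z≤n , ε , p ∷ []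
  prefix (e ◅ w) (p ∷ ps) (there g∈) with prefix w ps g∈
  ... | l′ , l′<l , w′ , ps′ = suc l′ , s≤s l′<l , e ◅ w′ , p ∷ ps′

  suffix : ∀ {P : V → Set} {u v l g} (w : Chain E u v l) → All P (vertices w) →
           g ∈ vertices w →
           Σ (Within P g v (_≤ l)) λ (_ , _ , w′ , _) → Unique (vertices w) → Unique (vertices w′)
  suffix w       ps       (here refl) = (_ , ≤-refl , w , ps) , λ uniq → uniq
  suffix (_ ◅ w) (_ ∷ ps) (there g∈)  with suffix w ps g∈
  ... | (l′ , l′≤l , w′ , ps′) , keep =
    (l′ , m≤n⇒m≤1+n l′≤l , w′ , ps′) , λ { (_ ∷ uniq) → keep uniq }

  initVertices-unique : ∀ {u v l} (w : Chain E u v l) →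
                        Unique (vertices w) → Unique (initVertices w)
  initVertices-unique ε       _             = []
  initVertices-unique (_ ◅ w) (u∉ ∷ uniq) =
    All.tabulate (λ g∈ → All.lookup u∉ (initVertices⊆vertices w g∈)) ∷ initVertices-unique w uniq

  last∉initVertices : ∀ {u v l} (w : Chain E u v l) → Unique (vertices w) → v ∉ initVertices w
  last∉initVertices (_ ◅ w) (u∉ ∷ _)    (here refl) = All.lookup u∉ (last∈vertices w) refl
  last∉initVertices (_ ◅ w) (_ ∷ uniq)  (there v∈)  = last∉initVertices w uniq v∈

  corner-disjoint : ∀ {u v w l l′} (w₁ : Chain E u v l) (w₂ : Chain E v w l′) →
                    Unique (vertices w₁) → Disjoint (initVertices w₁) (tailVertices w₂) →
                    Disjoint (initVertices w₁) (initVertices w₂)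
  corner-disjoint w₁ w₂ uniq d (g∈₁ , g∈₂) with initVertices⊆vertices w₂ g∈₂
  ... | here refl = last∉initVertices w₁ uniq g∈₁
  ... | there g∈  = d (g∈₁ , g∈)

  vertexAt : ∀ {u v l} → Chain E u v l → Fin (suc l) → V
  vertexAt {u} ε       _       = u
  vertexAt {u} (_ ◅ w) zero    = u
  vertexAt     (_ ◅ w) (suc i) = vertexAt w i

  vertexAt-first : ∀ {u v l} (w : Chain E u v l) → vertexAt w zero ≡ u
  vertexAt-first ε       = refl
  vertexAt-first (_ ◅ _) = refl

  vertexAt-last : ∀ {u v l} (w : Chain E u v l) → vertexAt w (fromℕ l) ≡ v
  vertexAt-last ε       = refl
  vertexAt-last (_ ◅ w) = vertexAt-last w

  vertexAt-step : ∀ {u v l} (w : Chain E u v l) (i : Fin l) →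
                  E (vertexAt w (inject₁ i)) (vertexAt w (suc i))
  vertexAt-step (e ◅ ε)       zero    = e
  vertexAt-step (e ◅ (_ ◅ _)) zero    = e
  vertexAt-step (_ ◅ w)       (suc i) = vertexAt-step w i

  toWalk : ∀ {u v l} → Chain E u v l → Walk E u v l
  toWalk w = record
    { vtx = vertexAt w ; start = vertexAt-first w ; end = vertexAt-last w ; step = vertexAt-step w }

  vertexAt-inject₁∈initVertices : ∀ {u v l} (w : Chain E u v l) (i : Fin l) →
                                  vertexAt w (inject₁ i) ∈ initVertices w
  vertexAt-inject₁∈initVertices (_ ◅ w) zero    = here refl
  vertexAt-inject₁∈initVertices (_ ◅ w) (suc i) = there (vertexAt-inject₁∈initVertices w i)

  initVertices-unique⇒injective : ∀ {u v l} (w : Chain E u v l) → Unique (initVertices w) →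
                                  ∀ i j → vertexAt w (inject₁ i) ≡ vertexAt w (inject₁ j) → i ≡ j
  initVertices-unique⇒injective (_ ◅ w) _           zero    zero    _  = refl
  initVertices-unique⇒injective (_ ◅ w) (u∉ ∷ _)    zero    (suc j) eq =
    ⊥-elim (All.lookup u∉ (vertexAt-inject₁∈initVertices w j) eq)
  initVertices-unique⇒injective (_ ◅ w) (u∉ ∷ _)    (suc i) zero    eq =
    ⊥-elim (All.lookup u∉ (vertexAt-inject₁∈initVertices w i) (≡.sym eq))
  initVertices-unique⇒injective (_ ◅ w) (_ ∷ uniq)  (suc i) (suc j) eq =
    cong suc (initVertices-unique⇒injective w uniq i j eq)

  fromVertices : (l : ℕ) (f : Fin (suc l) → V) → (∀ i → E (f (inject₁ i)) (f (suc i))) →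
                 Chain E (f zero) (f (fromℕ l)) l
  fromVertices zero    f steps = ε
  fromVertices (suc l) f steps = steps zero ◅ fromVertices l (λ i → f (suc i)) (λ i → steps (suc i))

  vertices-fromVertices : ∀ l f steps → vertices (fromVertices l f steps) ≡ tabulate f
  vertices-fromVertices zero    f steps = refl
  vertices-fromVertices (suc l) f steps =
    cong (f zero ∷_) (vertices-fromVertices l (λ i → f (suc i)) (λ i → steps (suc i)))

  fromWalk : ∀ {u v l} → Walk E u v l → Chain E u v l
  fromWalk {l = l} w =
    subst₂ (λ x y → Chain E x y l) (start w) (end w) (fromVertices l (vtx w) (step w))

  vertices-fromWalk : ∀ {u v l} (w : Walk E u v l) → vertices (fromWalk w) ≡ tabulate (vtx w)
  vertices-fromWalk {l = l} w =
    ≡.trans (vertices-subst₂ (start w) (end w) _) (vertices-fromVertices l (vtx w) (step w))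
    where
      vertices-subst₂ : ∀ {x y u v} (p : x ≡ u) (q : y ≡ v) (c : Chain E x y l) →
                        vertices (subst₂ (λ x y → Chain E x y l) p q c) ≡ vertices c
      vertices-subst₂ refl refl c = refl

  All-fromWalk : ∀ {P : V → Set} {u v l} (w : Walk E u v l) → (∀ i → P (vtx w i)) →
                 All P (vertices (fromWalk w))
  All-fromWalk {P} w ps = subst (All P) (≡.sym (vertices-fromWalk w)) (tabulate⁺ ps)

  vtx∈vertices-fromWalk : ∀ {u v l} (w : Walk E u v l) i → vtx w i ∈ vertices (fromWalk w)
  vtx∈vertices-fromWalk w i =
    subst (vtx w i ∈_) (≡.sym (vertices-fromWalk w)) (∈-tabulate⁺ {f = vtx w} i)

  module _ (_≟ᵥ_ : DecidableEquality V) where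
    open import Data.List.Membership.DecPropositional _≟ᵥ_ using (_∈?_)

    simplify : ∀ {P : V → Set} {u v l} (w : Chain E u v l) → All P (vertices w) →
               Σ (Within P u v (_≤ l)) λ (_ , _ , w′ , _) → Unique (vertices w′)
    simplify ε ps = (0 , z≤n , ε , ps) , [] ∷ []
    simplify {u = u} (e ◅ w) (p ∷ ps) with simplify w ps
    ... | (l′ , l′≤l , w′ , ps′) , uniq with u ∈? vertices w′
    ...   | no u∉  = (suc l′ , s≤s l′≤l , e ◅ w′ , p ∷ ps′) , ¬Any⇒All¬ _ u∉ ∷ uniq
    ...   | yes u∈ with suffix w′ ps′ u∈
    ...     | (l″ , l″≤l′ , w″ , ps″) , keep =
      (l″ , m≤n⇒m≤1+n (≤-trans l″≤l′ l′≤l) , w″ , ps″) , keep uniq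

    shortcut? : ∀ {P Q : V → Set} {u v w l l′} (w₁ : Chain E u v l) → All P (vertices w₁) →
                (w₂ : Chain E v w l′) → All Q (vertices w₂) →
                (∃ λ g → Within P u g (_< l) × Within Q g w (_≤ l′))
                ⊎ Disjoint (initVertices w₁) (tailVertices w₂)
    shortcut? w₁ ps w₂ qs with any? (_∈? tailVertices w₂) (initVertices w₁)
    ... | no none = inj₂ λ (g∈₁ , g∈₂) → none (lose g∈₁ g∈₂)
    ... | yes some with find some
    ...   | g , g∈₁ , g∈₂ = inj₁ (g , prefix w₁ ps g∈₁ , proj₁ (suffix w₂ qs (there g∈₂)))

module _ (Tr : Tree) where
  private
    E = TAdj Tr

  unique-cycle-impossible : ∀ {u l} (c : Chain E u u l) → 3 ≤ l → Unique (initVertices c) → ⊥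
  unique-cycle-impossible c 3≤l uniq =
    acyclic Tr (_ , _ , 3≤l , toWalk c , initVertices-unique⇒injective c uniq)

  module _ {X Y Z : Fin (m Tr) → Set} where

    simple-triangle-meets : ∀ {x y z l₁ l₂ l₃}
      (w₁ : Chain E z x l₁) → All X (vertices w₁) → Unique (vertices w₁) →
      (w₂ : Chain E x y l₂) → All Y (vertices w₂) → Unique (vertices w₂) →
      (w₃ : Chain E y z l₃) → All Z (vertices w₃) → Unique (vertices w₃) →
      Disjoint (initVertices w₁) (tailVertices w₂) →
      Disjoint (initVertices w₂) (tailVertices w₃) →
      Disjoint (initVertices w₃) (tailVertices w₁) →
      ∃ λ t → X t × Y t × Z t
    simple-triangle-meets w₁ xs _ ε ys _ w₃ zs _ _ _ _ =
      _ , All-last w₁ xs , All.head ys , All.head zs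
    simple-triangle-meets w₁ xs _ w₂@(_ ◅ _) ys _ ε zs _ _ _ _ =
      _ , All.head xs , All-last w₂ ys , All.head zs
    simple-triangle-meets ε xs _ w₂@(_ ◅ _) ys _ w₃@(_ ◅ _) zs _ _ _ _ =
      _ , All.head xs , All.head ys , All-last w₃ zs
    simple-triangle-meets w₁@(_ ◅ _) _ u₁ w₂@(_ ◅ _) _ u₂ w₃@(_ ◅ _) _ u₃ d₁₂ d₂₃ d₃₁ =
      ⊥-elim (unique-cycle-impossible (w₂ ◅◅ w₃ ◅◅ w₁)
        (+-mono-≤ (s≤s z≤n) (+-mono-≤ (s≤s z≤n) (s≤s z≤n))) unique)
      where
        unique : Unique (initVertices (w₂ ◅◅ w₃ ◅◅ w₁))
        unique = subst Unique
          (≡.sym (≡.trans (initVertices-◅◅ w₂ (w₃ ◅◅ w₁))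
                          (cong (initVertices w₂ ++_) (initVertices-◅◅ w₃ w₁))))
          (++⁺ (initVertices-unique w₂ u₂)
               (++⁺ (initVertices-unique w₃ u₃) (initVertices-unique w₁ u₁)
                    (corner-disjoint w₃ w₁ u₃ d₃₁))
               (Disjoint-++⁺ʳ (corner-disjoint w₂ w₃ u₂ d₂₃)
                              (λ (g∈₂ , g∈₁) → corner-disjoint w₁ w₂ u₁ d₁₂ (g∈₁ , g∈₂))))

    -- Removing repetitions and cutting across the crossings of two sides
    -- shortens the triangle until its sides are simple and meet only at the
    -- corners; it then closes a cycle of T unless one side is trivial.
    triangle-meets : ∀ {x y z l₁ l₂ l₃} → Acc _<_ (l₁ + l₂ + l₃) →
      (w₁ : Chain E z x l₁) → All X (vertices w₁) →
      (w₂ : Chain E x y l₂) → All Y (vertices w₂) →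
      (w₃ : Chain E y z l₃) → All Z (vertices w₃) →
      ∃ λ t → X t × Y t × Z t
    triangle-meets (acc smaller) w₁ xs w₂ ys w₃ zs
      with simplify _≟_ w₁ xs | simplify _≟_ w₂ ys | simplify _≟_ w₃ zs
    ... | (_ , ≤₁ , w₁′ , xs′) , u₁ | (_ , ≤₂ , w₂′ , ys′) , u₂ | (_ , ≤₃ , w₃′ , zs′) , u₃
      with shortcut? _≟_ w₁′ xs′ w₂′ ys′
         | shortcut? _≟_ w₂′ ys′ w₃′ zs′
         | shortcut? _≟_ w₃′ zs′ w₁′ xs′
    ... | inj₁ (_ , (_ , <₁ , c₁ , cxs) , (_ , ≤₂′ , c₂ , cys)) | _ | _ =
      triangle-meets
        (smaller (+-mono-<-≤ (+-mono-<-≤ (<-≤-trans <₁ ≤₁) (≤-trans ≤₂′ ≤₂)) ≤₃))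
        c₁ cxs c₂ cys w₃′ zs′
    ... | inj₂ _ | inj₁ (_ , (_ , <₂ , c₂ , cys) , (_ , ≤₃′ , c₃ , czs)) | _ =
      triangle-meets
        (smaller (+-mono-<-≤ (+-mono-≤-< ≤₁ (<-≤-trans <₂ ≤₂)) (≤-trans ≤₃′ ≤₃)))
        w₁′ xs′ c₂ cys c₃ czs
    ... | inj₂ _ | inj₂ _ | inj₁ (_ , (_ , <₃ , c₃ , czs) , (_ , ≤₁′ , c₁ , cxs)) =
      triangle-meets
        (smaller (+-mono-≤-< (+-mono-≤ (≤-trans ≤₁′ ≤₁) ≤₂) (<-≤-trans <₃ ≤₃)))
        c₁ cxs w₂′ ys′ c₃ czs
    ... | inj₂ d₁₂ | inj₂ d₂₃ | inj₂ d₃₁ =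
      simple-triangle-meets w₁′ xs′ u₁ w₂′ ys′ u₂ w₃′ zs′ u₃ d₁₂ d₂₃ d₃₁

    subtree-helly : ∀ {x y z l₁ l₂ l₃} →
      (w₁ : Chain E z x l₁) → All X (vertices w₁) →
      (w₂ : Chain E x y l₂) → All Y (vertices w₂) →
      (w₃ : Chain E y z l₃) → All Z (vertices w₃) →
      ∃ λ t → X t × Y t × Z t
    subtree-helly = triangle-meets (<-wellFounded _)

m+n≤o⇒m+m≤o⊎n+n≤o : ∀ {m n o} → m + n ≤ o → m + m ≤ o ⊎ n + n ≤ o
m+n≤o⇒m+m≤o⊎n+n≤o {m} {n} m+n≤o with m ≤? n
... | yes m≤n = inj₁ (≤-trans (+-monoʳ-≤ m m≤n) m+n≤o)
... | no  m≰n = inj₂ (≤-trans (+-monoˡ-≤ n (<⇒≤ (≰⇒> m≰n))) m+n≤o)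

m+m≤n⇒m+n≤threeHalves[n] : ∀ {m n} → m + m ≤ n → m + n ≤ threeHalves n
m+m≤n⇒m+n≤threeHalves[n] {m} {n} m+m≤n = begin
  m + n               ≡⟨ m*n/n≡m (m + n) 2 ⟨
  (m + n) * 2 / 2     ≤⟨ /-monoˡ-≤ 2 (begin
      (m + n) * 2     ≡⟨ solve 2 (λ m n → (m :+ n) :* con 2 := (m :+ m) :+ (n :+ n)) refl m n ⟩
      (m + m) + (n + n) ≤⟨ +-monoˡ-≤ (n + n) m+m≤n ⟩
      n + (n + n)     ≡⟨ solve 1 (λ n → n :+ (n :+ n) := con 3 :* n) refl n ⟩
      3 * n           ∎) ⟩
  3 * n / 2           ∎
  where open ≤-Reasoning
        open +-*-Solver

outer+middle≤outer⇒middle≤ : ∀ a b c d e → (a + b) + (c + d) ≤ a + (e + d) → b + c ≤ e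
outer+middle≤outer⇒middle≤ a b c d e le =
  +-cancelʳ-≤ d (b + c) e (+-cancelˡ-≤ a _ _ (subst (_≤ a + (e + d)) regroup le))
  where
    open +-*-Solver
    regroup : (a + b) + (c + d) ≡ a + ((b + c) + d)
    regroup = solve 4 (λ a b c d → (a :+ b) :+ (c :+ d) := a :+ ((b :+ c) :+ d)) refl a b c d

module _ {G : Graph} (D : TreeDecomposition G) where

  BagMeets : (Fin (n G) → Set) → Fin (m (T D)) → Set
  BagMeets P t = ∃ λ g → P g × bag D t g

  All-BagMeets-fromWalk : ∀ {P : Fin (n G) → Set} {u s s′ L} (path : Walk (TAdj (T D)) s s′ L) →
                          WalkWithin (λ t → bag D t u) path → P u →
                          All (BagMeets P) (vertices (fromWalk path))
  All-BagMeets-fromWalk {u = u} path inBags p =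
    All.map (λ t∋u → u , p , t∋u) (All-fromWalk path inBags)

  connectBags : ∀ {P : Fin (n G) → Set} {u u′ l t t′} (w : Chain (Adj G) u u′ l) →
                All P (vertices w) → bag D t u → bag D t′ u′ →
                ∃₂ λ L (c : Chain (TAdj (T D)) t t′ L) → All (BagMeets P) (vertices c)
  connectBags {u = u} ε (p ∷ []) t∋u t′∋u with subtree D u _ _ t∋u t′∋u
  ... | _ , path , inBags = _ , fromWalk path , All-BagMeets-fromWalk path inBags p
  connectBags {u = u} (e ◅ w) (p ∷ ps) t∋u t′∋u′ with edges D _ _ e
  ... | s , s∋u , s∋w with subtree D u _ s t∋u s∋u | connectBags w ps s∋w t′∋u′
  ... | _ , path , inBags | _ , c , meets =
    _ , fromWalk path ◅◅ c , All-◅◅ (fromWalk path) c (All-BagMeets-fromWalk path inBags p) meets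

  module _ {A : Fin (n G) → Set} (connA : InducedConnected G A) where

    commonBag : ∀ {a b v l₁ l₂} (w₁ : Chain (Adj G) a v l₁) (w₂ : Chain (Adj G) v b l₂) →
                A a → A b →
                ∃ λ t → BagMeets (_∈ vertices w₁) t × BagMeets (_∈ vertices w₂) t × BagMeets A t
    commonBag {a} {b} {v} w₁ w₂ Aa Ab
      with covers D a | covers D v | covers D b | connA b a Ab Aa
    ... | _ , ta∋a | _ , tv∋v | _ , tb∋b | _ , ba , ba⊆A
      with connectBags w₁ (All.tabulate (λ g∈ → g∈)) ta∋a tv∋v
         | connectBags w₂ (All.tabulate (λ g∈ → g∈)) tv∋v tb∋b
         | connectBags (fromWalk ba) (All-fromWalk ba ba⊆A) tb∋b ta∋a
    ... | _ , c₁ , meets₁ | _ , c₂ , meets₂ | _ , c₃ , meets₃ =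
      subtree-helly (T D) c₁ meets₁ c₂ meets₂ c₃ meets₃

module _ {G : Graph} {k : ℕ} {A : Fin (n G) → Set} where

  near-A-via : ∀ {v g q j} → Chain (Adj G) v g j → j + j ≤ k → DistLe G g q k → A q →
               N≤ G (threeHalves k) A v
  near-A-via {j = j} w j+j≤k (L , L≤k , path) Aq =
    _ , Aq , j + L , ≤-trans (+-monoʳ-≤ j L≤k) (m+m≤n⇒m+n≤threeHalves[n] j+j≤k) ,
    toWalk (w ◅◅ fromWalk path)

  geodesic-near-A : TreelengthAtMost G k → InducedConnected G A →
                    ∀ {a b v l₁ l₂} (w₁ : Chain (Adj G) a v l₁) (w₂ : Chain (Adj G) v b l₂) →
                    A a → A b → (∀ l′ → Chain (Adj G) a b l′ → l₁ + l₂ ≤ l′) →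
                    N≤ G (threeHalves k) A v
  geodesic-near-A (D , lenD) connA w₁ w₂ Aa Ab shortest with commonBag D connA w₁ w₂ Aa Ab
  ... | t , (g₁ , g₁∈ , t∋g₁) , (g₂ , g₂∈ , t∋g₂) , (q , Aq , t∋q)
    with split w₁ g₁∈ | split w₂ g₂∈ | lenD t g₁ g₂ t∋g₁ t∋g₂
  ... | j₀ , j₁ , refl , p₀ , p₁ | j₂ , j₃ , refl , p₂ , p₃ | L , L≤k , chord
    with m+n≤o⇒m+m≤o⊎n+n≤o {j₁} {j₂} (≤-trans (outer+middle≤outer⇒middle≤ j₀ j₁ j₂ j₃ L
                                        (shortest _ (p₀ ◅◅ fromWalk chord ◅◅ p₃))) L≤k)
  ... | inj₁ j₁+j₁≤k = near-A-via (reverse (Graph.sym G) p₁) j₁+j₁≤k (lenD t g₁ q t∋g₁ t∋q) Aq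
  ... | inj₂ j₂+j₂≤k = near-A-via p₂ j₂+j₂≤k (lenD t g₂ q t∋g₂ t∋q) Aq

lemma2 : (G : Graph) (k : ℕ) → 1 ≤ k → TreelengthAtMost G k →
         (A : Fin (n G) → Set) → InducedConnected G A →
         (a b : Fin (n G)) → A a → A b →
         (l : ℕ) (p : Walk (Adj G) a b l) → IsShortestPath G p →
         (i : Fin (suc l)) → N≤ G (threeHalves k) A (vtx p i)
lemma2 G k _ decomposition A connA a b Aa Ab l p shortest i
  with split (fromWalk p) (vtx∈vertices-fromWalk p i)
... | l₁ , l₂ , refl , w₁ , w₂ =
  geodesic-near-A decomposition connA w₁ w₂ Aa Ab (λ l′ w → shortest l′ (toWalk w))
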